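{- Let $S$ be a numerical semigroup with multiplicity $m$ and conductor $c=f+1$; write $c=qm-\rho$ with $q=\lceil c/m\rceil$ and $0\le\rho<m$. Let $\mathrm{Ap}(S,m)=\{w_0=0<w_1<\dots<w_{m-1}\}$. For $k\in\mathbb N$ let $I_k=\{km-\rho,km-\rho+1,\dots,(k+1)m-\rho-1\}$, and for $j\in\{1,\dots,m-1\}$ let $\eta_j=|\{k\in\mathbb N: |I_k\cap S|=j\}|$. Then for all $j\in\{1,\dots,m-1\}$, $$\eta_j=\left\lfloor\frac{w_j+\rho}{m}\right\rfloor-\left\lfloor\frac{w_{j-1}+\rho}{m}\right\rfloor.$$
   Context: A numerical semigroup is a submonoid of $(\mathbb N,+)$ with finite complement; $f$ is its largest non-element and $m$ its smallest nonzero element. $\mathrm{Ap}(S,m)=\{s\in S: s-m\notin S\}$, an $m$-element set listed increasingly. -}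

module Defs where

open import Data.Bool using (Bool; true; false; if_then_else_)
open import Data.Nat using (ℕ; zero; suc; _+_; _*_; _∸_; _≤_; _<_; _≤ᵇ_)
open import Data.List using (List; upTo; map)
open import Data.Nat.ListAction using (sum)
open import Data.Product using (_×_; Σ; ∃)
open import Data.Empty using (⊥)
open import Relation.Binary.PropositionalEquality using (_≡_)

NSet : Set
NSet = ℕ → Bool

_∈ₛ_ : ℕ → NSet → Set
n ∈ₛ S = S n ≡ true

_∉ₛ_ : ℕ → NSet → Set
n ∉ₛ S = S n ≡ false

record IsNumericalSemigroup (S : NSet) : Set where
  field
    zero∈ : 0 ∈ₛ S
    +-closed : ∀ a b → a ∈ₛ S → b ∈ₛ S → (a + b) ∈ₛ S
    cofinite : ∃ λ N → ∀ n → N ≤ n → n ∈ₛ S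

record IsMultiplicity (S : NSet) (m : ℕ) : Set where
  field
    pos : 1 ≤ m
    m∈ : m ∈ₛ S
    minimal : ∀ n → 1 ≤ n → n < m → n ∉ₛ S

-- c is the conductor f+1, f the largest non-element (f = -1, c = 0 for S = ℕ).
record IsConductor (S : NSet) (c : ℕ) : Set where
  field
    above : ∀ n → c ≤ n → n ∈ₛ S
    frob∉ : ∀ f → suc f ≡ c → f ∉ₛ S

-- Apéry set Ap(S,m) = {s ∈ S : s - m ∉ S} (s - m < 0 counts as ∉ S).
InApery : NSet → ℕ → ℕ → Set
InApery S m s = s ∈ₛ S × (m ≤ s → (s ∸ m) ∉ₛ S)

-- w₀ < w₁ < … < w_{m-1} is the increasing enumeration of Ap(S,m)
-- (only the values w i with i < m matter).
record IsAperyListing (S : NSet) (m : ℕ) (w : ℕ → ℕ) : Set where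
  field
    inAp : ∀ i → i < m → InApery S m (w i)
    increasing : ∀ i j → i < j → j < m → w i < w j
    covers : ∀ s → InApery S m s → Σ ℕ λ i → i < m × w i ≡ s

-- |I_k ∩ S| where I_k = {km-ρ, …, (k+1)m-ρ-1} ⊆ ℤ; negative integers are not in S.
countIk : NSet → ℕ → ℕ → ℕ → ℕ
countIk S m ρ k = sum (map f (upTo m))
  where
    f : ℕ → ℕ
    f i = if ρ ≤ᵇ (k * m + i)
          then (if S ((k * m + i) ∸ ρ) then 1 else 0)
          else 0

-- Shifting by ρ turns I_k into the block {km, …, km+m−1} of the translate ρ + S.  Each Apéry
-- element w_i lies in its own residue class r_i of w_i + ρ modulo m, and there ρ + S consists of
-- exactly the numbers k m + r_i with k ≥ a_i = ⌊(w_i + ρ)/m⌋.  As i ↦ r_i is a bijection onto the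
-- residues, |I_k ∩ S| = #{i < m : a_i ≤ k}; since a is monotone this count equals j exactly for
-- a_{j−1} ≤ k < a_j.
module Submission where

open import Defs
open import Data.Nat using (ℕ; NonZero; zero; suc; _+_; _*_; _∸_; _/_; _%_; _≤ᵇ_; _≤_; _<_; _≤?_;
  z≤n; s≤s; s≤s⁻¹)
open import Data.Nat.Properties hiding (_≟_)
open import Data.Nat.DivMod using (m≡m%n+[m/n]*n; m%n<n; /-monoˡ-≤)
open import Data.Nat.ListAction using (sum)
open import Data.Nat.Tactic.RingSolver using (solve-∀)
open import Data.Bool using (Bool; true; false; if_then_else_)
open import Data.Bool.Properties using (T-≡; ¬-not)
open import Data.Fin using (Fin; toℕ; fromℕ<; punchOut)
open import Data.Fin.Properties using (toℕ<n; toℕ-fromℕ<; toℕ-injective; any?; _≟_;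
  punchOut-injective; injective⇒≤)
open import Data.Fin.Permutation using (Permutation′; permutation)
open import Data.List using (applyUpTo)
open import Data.List.Properties using (map-upTo)
open import Data.Product using (Σ; _,_; _×_; ∃; proj₁; proj₂)
open import Data.Product.Properties using (Σ-≡,≡→≡)
open import Data.Sum using (inj₁; inj₂)
open import Data.Empty using (⊥)
open import Function using (_∘_; Injective)
open import Function.Bundles using (_↔_; _⇔_; mk⇔; mk↔ₛ′; Equivalence)
open import Relation.Binary.PropositionalEquality
  using (_≡_; _≢_; refl; sym; trans; cong; subst; module ≡-Reasoning)
open import Relation.Binary.Definitions using (tri<; tri≈; tri>)
open import Relation.Nullary using (yes; no; contradiction; Irrelevant)
open import Algebra.Properties.CommutativeSemigroup +-commutativeSemigroup
  using (xy∙z≈xz∙y; x∙yz≈y∙xz)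
open import Algebra.Properties.CommutativeMonoid.Sum +-0-commutativeMonoid
  using (sum-syntax; sum-cong-≗; ∑-permute)

indicator : Bool → ℕ
indicator b = if b then 1 else 0

indicator≤1 : ∀ b → indicator b ≤ 1
indicator≤1 true  = ≤-refl
indicator≤1 false = z≤n

≤⇒≤ᵇ≡true : ∀ {a b} → a ≤ b → (a ≤ᵇ b) ≡ true
≤⇒≤ᵇ≡true a≤b = Equivalence.to T-≡ (≤⇒≤ᵇ a≤b)

>⇒≤ᵇ≡false : ∀ {a b} → b < a → (a ≤ᵇ b) ≡ false
>⇒≤ᵇ≡false {a} {b} b<a = ¬-not λ e → <⇒≱ b<a (≤ᵇ⇒≤ a b (Equivalence.from T-≡ e))

sum-applyUpTo : ∀ (g : ℕ → ℕ) n → sum (applyUpTo g n) ≡ ∑[ i < n ] g (toℕ i)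
sum-applyUpTo g zero    = refl
sum-applyUpTo g (suc n) = cong (g 0 +_) (sum-applyUpTo (g ∘ suc) n)

count≤ : ℕ → (ℕ → ℕ) → ℕ → ℕ
count≤ n a k = ∑[ i < n ] indicator (a (toℕ i) ≤ᵇ k)

count≤-≤ : ∀ n a k p → (∀ i → p ≤ i → i < n → k < a i) → count≤ n a k ≤ p
count≤-≤ zero    a k p       _     = z≤n
count≤-≤ (suc n) a k zero    large =
  +-mono-≤ (≤-reflexive (cong indicator (>⇒≤ᵇ≡false (large 0 z≤n (s≤s z≤n)))))
           (count≤-≤ n (a ∘ suc) k 0 λ i _ i<n → large (suc i) z≤n (s≤s i<n))
count≤-≤ (suc n) a k (suc p) large =
  +-mono-≤ (indicator≤1 _)
           (count≤-≤ n (a ∘ suc) k p λ i p≤i i<n → large (suc i) (s≤s p≤i) (s≤s i<n))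

count≤-≥ : ∀ n a k p → p ≤ n → (∀ i → i < p → a i ≤ k) → p ≤ count≤ n a k
count≤-≥ n       a k zero    _         _     = z≤n
count≤-≥ (suc n) a k (suc p) (s≤s p≤n) small
  rewrite ≤⇒≤ᵇ≡true (small 0 (s≤s z≤n)) =
  s≤s (count≤-≥ n (a ∘ suc) k p p≤n λ i i<p → small (suc i) (s≤s i<p))

MonotoneBelow : ℕ → (ℕ → ℕ) → Set
MonotoneBelow n a = ∀ i j → i ≤ j → j < n → a i ≤ a j

StrictlyIncreasingBelow : ℕ → (ℕ → ℕ) → Set
StrictlyIncreasingBelow n a = ∀ i j → i < j → j < n → a i < a j

strictlyIncreasing⇒monotone : ∀ {n a} → StrictlyIncreasingBelow n a → MonotoneBelow n a
strictlyIncreasing⇒monotone incr i j i≤j j<n with m≤n⇒m<n∨m≡n i≤j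
... | inj₁ i<j  = <⇒≤ (incr i j i<j j<n)
... | inj₂ refl = ≤-refl

strictlyIncreasing⇒injective : ∀ {n a} → StrictlyIncreasingBelow n a →
                               ∀ i j → i < n → j < n → a i ≡ a j → i ≡ j
strictlyIncreasing⇒injective incr i j i<n j<n e with <-cmp i j
... | tri< i<j _ _ = contradiction e (<⇒≢ (incr i j i<j j<n))
... | tri≈ _ i≡j _ = i≡j
... | tri> _ _ j<i = contradiction (sym e) (<⇒≢ (incr j i j<i i<n))

count≤≡suc⇔ : ∀ {n a k j} → MonotoneBelow n a → suc j < n →
              count≤ n a k ≡ suc j ⇔ (a j ≤ k × k < a (suc j))
count≤≡suc⇔ {n} {a} {k} {j} mono 1+j<n = mk⇔ to from
  where
  j<n : j < n
  j<n = <-trans (n<1+n j) 1+j<n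

  to : count≤ n a k ≡ suc j → a j ≤ k × k < a (suc j)
  to e with a j ≤? k | a (suc j) ≤? k
  ... | no aj≰k | _ = contradiction (subst (_≤ j) e
          (count≤-≤ n a k j λ i j≤i i<n → <-≤-trans (≰⇒> aj≰k) (mono j i j≤i i<n)))
          1+n≰n
  ... | yes _ | yes a1+j≤k = contradiction (subst (suc (suc j) ≤_) e
          (count≤-≥ n a k (suc (suc j)) 1+j<n
            λ i i<2+j → ≤-trans (mono i (suc j) (s≤s⁻¹ i<2+j) 1+j<n) a1+j≤k))
          1+n≰n
  ... | yes aj≤k | no a1+j≰k = aj≤k , ≰⇒> a1+j≰k

  from : a j ≤ k × k < a (suc j) → count≤ n a k ≡ suc j
  from (aj≤k , k<a1+j) = ≤-antisym
    (count≤-≤ n a k (suc j) λ i 1+j≤i i<n → <-≤-trans k<a1+j (mono (suc j) i 1+j≤i i<n))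
    (count≤-≥ n a k (suc j) (<⇒≤ 1+j<n)
      λ i i<1+j → ≤-trans (mono i j (s≤s⁻¹ i<1+j) j<n) aj≤k)

injective⇒surjective : ∀ {n} (f : Fin n → Fin n) → Injective _≡_ _≡_ f →
                       ∀ t → ∃ λ i → f i ≡ t
injective⇒surjective {suc n} f inj t with any? (λ i → f i ≟ t)
... | yes hit = hit
... | no miss = contradiction (injective⇒≤ punchOut∘f-injective) 1+n≰n
  where
  t≢f : ∀ i → t ≢ f i
  t≢f i e = miss (i , sym e)

  punchOut∘f : Fin (suc n) → Fin n
  punchOut∘f i = punchOut (t≢f i)

  punchOut∘f-injective : Injective _≡_ _≡_ punchOut∘f
  punchOut∘f-injective {i} {i′} e = inj (punchOut-injective (t≢f i) (t≢f i′) e)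

injective⇒permutation : ∀ {n} (f : Fin n → Fin n) → Injective _≡_ _≡_ f → Permutation′ n
injective⇒permutation f inj =
  permutation f f⁻¹ (proj₂ ∘ preimage) (λ i → inj (proj₂ (preimage (f i))))
  where
  preimage = injective⇒surjective f inj
  f⁻¹ = proj₁ ∘ preimage

interval↔ : ∀ {a b} {P : ℕ → Set} → (∀ {k} → Irrelevant (P k)) →
            (∀ k → P k ⇔ (a ≤ k × k < b)) → Fin (b ∸ a) ↔ Σ ℕ P
interval↔ {a} {b} {P} irr P⇔ = mk↔ₛ′ to from to∘from from∘to
  where
  a≤b : Fin (b ∸ a) → a ≤ b
  a≤b x = <⇒≤ (m∸n≢0⇒n<m λ e → n≮0 (subst (toℕ x <_) e (toℕ<n x)))

  to : Fin (b ∸ a) → Σ ℕ P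
  to x = a + toℕ x , Equivalence.from (P⇔ _) (m≤m+n a (toℕ x) , a+x<b)
    where
    a+x<b : a + toℕ x < b
    a+x<b = subst (a + toℕ x <_) (m+[n∸m]≡n (a≤b x)) (+-monoʳ-< a (toℕ<n x))

  from : Σ ℕ P → Fin (b ∸ a)
  from (k , p) = let (a≤k , k<b) = Equivalence.to (P⇔ k) p in fromℕ< (∸-monoˡ-< k<b a≤k)

  to∘from : ∀ y → to (from y) ≡ y
  to∘from (k , p) = Σ-≡,≡→≡ (a+[k∸a]≡k , irr _ _)
    where
    a+[k∸a]≡k : a + toℕ (from (k , p)) ≡ k
    a+[k∸a]≡k = trans (cong (a +_) (toℕ-fromℕ< _)) (m+[n∸m]≡n (proj₁ (Equivalence.to (P⇔ k) p)))

  from∘to : ∀ x → from (to x) ≡ x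
  from∘to x = toℕ-injective (trans (toℕ-fromℕ< _) (m+n∸m≡n a (toℕ x)))

-- countIk S m ρ k is definitionally the sum of this indicator of ρ + S over k m, …, k m + m − 1.
shiftIndicator : NSet → ℕ → ℕ → ℕ
shiftIndicator S ρ n = if ρ ≤ᵇ n then indicator (S (n ∸ ρ)) else 0

shiftIndicator-+ : ∀ S ρ s → shiftIndicator S ρ (ρ + s) ≡ indicator (S s)
shiftIndicator-+ S ρ s rewrite ≤⇒≤ᵇ≡true (m≤m+n ρ s) | m+n∸m≡n ρ s = refl

shiftIndicator-∉ : ∀ S ρ n → (ρ ≤ n → (n ∸ ρ) ∈ₛ S → ⊥) → shiftIndicator S ρ n ≡ 0
shiftIndicator-∉ S ρ n ∉ with ρ ≤? n
... | no ρ≰n rewrite >⇒≤ᵇ≡false (≰⇒> ρ≰n) = refl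
... | yes ρ≤n rewrite ≤⇒≤ᵇ≡true ρ≤n = cong indicator (¬-not (∉ ρ≤n))

module _ {S : NSet} (ns : IsNumericalSemigroup S) {m : ℕ} (m∈ : m ∈ₛ S) where
  open IsNumericalSemigroup ns
  open ≡-Reasoning

  multiple∈ : ∀ d → (d * m) ∈ₛ S
  multiple∈ zero    = zero∈
  multiple∈ (suc d) = +-closed m (d * m) m∈ (multiple∈ d)

  Apéry-least : ∀ {w x} d → InApery S m w → x ∈ₛ S → x + suc d * m ≢ w
  Apéry-least {x = x} d (_ , w∸m∉) x∈ refl =
    contradiction (trans (sym x+dm∈) (w∸m∉ m≤w)) λ ()
    where
    w∸m≡x+dm : (x + suc d * m) ∸ m ≡ x + d * m
    w∸m≡x+dm = trans (cong (_∸ m) (x∙yz≈y∙xz x m (d * m))) (m+n∸m≡n m (x + d * m))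

    m≤w : m ≤ x + suc d * m
    m≤w = ≤-trans (m≤m+n m (d * m)) (m≤n+m (suc d * m) x)

    x+dm∈ : ((x + suc d * m) ∸ m) ∈ₛ S
    x+dm∈ = subst (_∈ₛ S) (sym w∸m≡x+dm) (+-closed x (d * m) x∈ (multiple∈ d))

  Apéry-congruent-< : ∀ {u v a b} → InApery S m u → v ∈ₛ S → a < b → u + a * m ≢ v + b * m
  Apéry-congruent-< {u} {v} {a} {b} u∈Ap v∈ a<b e = Apéry-least d u∈Ap v∈ (sym u≡v+[1+d]m)
    where
    d = b ∸ suc a

    regroup : ∀ v a d m → v + (suc a + d) * m ≡ v + suc d * m + a * m
    regroup = solve-∀

    u≡v+[1+d]m : u ≡ v + suc d * m
    u≡v+[1+d]m = +-cancelʳ-≡ (a * m) u _ (begin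
      u + a * m               ≡⟨ e ⟩
      v + b * m               ≡⟨ cong (λ c → v + c * m) (m+[n∸m]≡n a<b) ⟨
      v + (suc a + d) * m     ≡⟨ regroup v a d m ⟩
      v + suc d * m + a * m   ∎)

  Apéry-congruent⇒≡ : ∀ {u v a b} → InApery S m u → InApery S m v → u + a * m ≡ v + b * m → u ≡ v
  Apéry-congruent⇒≡ {a = a} {b} u∈Ap v∈Ap e with <-cmp a b
  ... | tri< a<b _ _ = contradiction e (Apéry-congruent-< u∈Ap (proj₁ v∈Ap) a<b)
  ... | tri≈ _ refl _ = +-cancelʳ-≡ (a * m) _ _ e
  ... | tri> _ _ b<a = contradiction (sym e) (Apéry-congruent-< v∈Ap (proj₁ u∈Ap) b<a)

  shiftIndicator-Apéry : ∀ {u ρ r a} → InApery S m u → u + ρ ≡ r + a * m →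
                         ∀ k → shiftIndicator S ρ (k * m + r) ≡ indicator (a ≤ᵇ k)
  shiftIndicator-Apéry {u} {ρ} {r} {a} u∈Ap u+ρ≡ k with a ≤? k
  ... | yes a≤k rewrite ≤⇒≤ᵇ≡true a≤k = begin
      shiftIndicator S ρ (k * m + r)          ≡⟨ cong (shiftIndicator S ρ) n≡ρ+[u+em] ⟩
      shiftIndicator S ρ (ρ + (u + e * m))    ≡⟨ shiftIndicator-+ S ρ (u + e * m) ⟩
      indicator (S (u + e * m))               ≡⟨ cong indicator u+em∈ ⟩
      1                                       ∎
    where
    e = k ∸ a

    u+em∈ : (u + e * m) ∈ₛ S
    u+em∈ = +-closed u (e * m) (proj₁ u∈Ap) (multiple∈ e)

    regroup₁ : ∀ a e m r → (a + e) * m + r ≡ (r + a * m) + e * m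
    regroup₁ = solve-∀

    regroup₂ : ∀ u ρ x → (u + ρ) + x ≡ ρ + (u + x)
    regroup₂ = solve-∀

    n≡ρ+[u+em] : k * m + r ≡ ρ + (u + e * m)
    n≡ρ+[u+em] = begin
      k * m + r               ≡⟨ cong (λ c → c * m + r) (m+[n∸m]≡n a≤k) ⟨
      (a + e) * m + r         ≡⟨ regroup₁ a e m r ⟩
      (r + a * m) + e * m     ≡⟨ cong (_+ e * m) u+ρ≡ ⟨
      (u + ρ) + e * m         ≡⟨ regroup₂ u ρ (e * m) ⟩
      ρ + (u + e * m)         ∎
  ... | no a≰k rewrite >⇒≤ᵇ≡false (≰⇒> a≰k) =
    shiftIndicator-∉ S ρ (k * m + r) λ ρ≤n s∈ →
      Apéry-least d u∈Ap s∈ (+-cancelʳ-≡ ρ _ _ (s+[1+d]m+ρ≡u+ρ ρ≤n))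
    where
    d = a ∸ suc k

    regroup : ∀ k m r d → k * m + r + suc d * m ≡ r + (suc k + d) * m
    regroup = solve-∀

    s+[1+d]m+ρ≡u+ρ : ρ ≤ k * m + r → (k * m + r ∸ ρ) + suc d * m + ρ ≡ u + ρ
    s+[1+d]m+ρ≡u+ρ ρ≤n = begin
      (k * m + r ∸ ρ) + suc d * m + ρ      ≡⟨ xy∙z≈xz∙y (k * m + r ∸ ρ) (suc d * m) ρ ⟩
      (k * m + r ∸ ρ) + ρ + suc d * m      ≡⟨ cong (_+ suc d * m) (m∸n+n≡m ρ≤n) ⟩
      k * m + r + suc d * m                ≡⟨ regroup k m r d ⟩
      r + (suc k + d) * m                  ≡⟨ cong (λ c → r + c * m) (m+[n∸m]≡n (≰⇒> a≰k)) ⟩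
      r + a * m                            ≡⟨ u+ρ≡ ⟨
      u + ρ                                ∎

module ResidueClasses {S : NSet} (ns : IsNumericalSemigroup S) {m : ℕ} .{{_ : NonZero m}}
                      (m∈ : m ∈ₛ S) (ρ : ℕ) {w : ℕ → ℕ} (ap : IsAperyListing S m w) where
  open IsAperyListing ap
  open ≡-Reasoning

  a r : ℕ → ℕ
  a i = (w i + ρ) / m
  r i = (w i + ρ) % m

  w+ρ≡r+a*m : ∀ i → w i + ρ ≡ r i + a i * m
  w+ρ≡r+a*m i = m≡m%n+[m/n]*n (w i + ρ) m

  a-monotone : MonotoneBelow m a
  a-monotone i j i≤j j<m =
    /-monoˡ-≤ m (+-monoˡ-≤ ρ (strictlyIncreasing⇒monotone increasing i j i≤j j<m))

  r-injective : ∀ i j → i < m → j < m → r i ≡ r j → i ≡ j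
  r-injective i j i<m j<m ri≡rj = strictlyIncreasing⇒injective increasing i j i<m j<m
    (Apéry-congruent⇒≡ ns m∈ {a = a j} {a i} (inAp i i<m) (inAp j j<m) (+-cancelʳ-≡ ρ _ _ (begin
      w i + a j * m + ρ            ≡⟨ xy∙z≈xz∙y (w i) (a j * m) ρ ⟩
      w i + ρ + a j * m            ≡⟨ cong (_+ a j * m) (w+ρ≡r+a*m i) ⟩
      r i + a i * m + a j * m      ≡⟨ cong (λ c → c + a i * m + a j * m) ri≡rj ⟩
      r j + a i * m + a j * m      ≡⟨ xy∙z≈xz∙y (r j) (a i * m) (a j * m) ⟩
      r j + a j * m + a i * m      ≡⟨ cong (_+ a i * m) (w+ρ≡r+a*m j) ⟨
      w j + ρ + a i * m            ≡⟨ xy∙z≈xz∙y (w j) ρ (a i * m) ⟩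
      w j + a i * m + ρ            ∎)))

  residue : Fin m → Fin m
  residue i = fromℕ< (m%n<n (w (toℕ i) + ρ) m)

  residue-injective : Injective _≡_ _≡_ residue
  residue-injective {i} {j} e = toℕ-injective (r-injective _ _ (toℕ<n i) (toℕ<n j)
    (trans (sym (toℕ-fromℕ< _)) (trans (cong toℕ e) (toℕ-fromℕ< _))))

  countIk≡count≤ : ∀ k → countIk S m ρ k ≡ count≤ m a k
  countIk≡count≤ k = begin
    countIk S m ρ k                       ≡⟨ cong sum (map-upTo block m) ⟩
    sum (applyUpTo block m)               ≡⟨ sum-applyUpTo block m ⟩
    ∑[ t < m ] block (toℕ t)              ≡⟨ ∑-permute (block ∘ toℕ) σ ⟩
    ∑[ i < m ] block (toℕ (residue i))    ≡⟨ sum-cong-≗ block∘residue ⟩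
    count≤ m a k                          ∎
    where
    block : ℕ → ℕ
    block t = shiftIndicator S ρ (k * m + t)

    σ : Permutation′ m
    σ = injective⇒permutation residue residue-injective

    block∘residue : ∀ i → block (toℕ (residue i)) ≡ indicator (a (toℕ i) ≤ᵇ k)
    block∘residue i = trans (cong block (toℕ-fromℕ< _))
      (shiftIndicator-Apéry ns m∈ {a = a (toℕ i)} (inAp (toℕ i) (toℕ<n i)) (w+ρ≡r+a*m (toℕ i)) k)

proposition2 : (S : NSet) → IsNumericalSemigroup S →
    (m : ℕ) → .{{_ : NonZero m}} → IsMultiplicity S m →
    (c : ℕ) → IsConductor S c →
    (q ρ : ℕ) → c + ρ ≡ q * m → ρ < m →
    (w : ℕ → ℕ) → IsAperyListing S m w →
    (j : ℕ) → 1 ≤ j → j < m →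
    Fin (((w j + ρ) / m) ∸ ((w (j ∸ 1) + ρ) / m)) ↔ Σ ℕ (λ k → countIk S m ρ k ≡ j)
proposition2 S ns m mu _ _ _ ρ _ _ w ap (suc j) _ 1+j<m =
  interval↔ ≡-irrelevant λ k →
    subst (λ n → (n ≡ suc j) ⇔ (a j ≤ k × k < a (suc j)))
          (sym (countIk≡count≤ k)) (count≤≡suc⇔ a-monotone 1+j<m)
  where open ResidueClasses ns (IsMultiplicity.m∈ mu) ρ ap
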